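{- Let $\mathcal{L}$ be a finite meet-semidistributive lattice. Then $\bigvee\mathrm{Atoms}(\mathcal{L})=\hat{1}$ if and only if $\mu_{\mathcal{L}}(\hat{0},\hat{1})\neq 0$.
   Context: A finite lattice is meet-semidistributive if for all $x,y,z$ with $x\wedge y=x\wedge z$ one has $x\wedge(y\vee z)=x\wedge y$. $\mathrm{Atoms}(\mathcal{L})$ is the set of elements covering $\hat0$. $\mu_{\mathcal{L}}$ is the Möbius function: $\mu(x,x)=1$, $\mu(x,y)=-\sum_{x\le z<y}\mu(x,z)$ for $x<y$, and $0$ otherwise. -}

module Defs where

open import Data.Nat using (ℕ; zero; suc)
open import Data.Fin using (Fin)
open import Data.Fin.Properties using (_≟_; all?)
open import Data.List using (List; foldr; filter)
open import Data.Fin.Base using ()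
open import Data.List.Base using ()
open import Data.Vec.Functional using ()
open import Data.Integer using (ℤ; 0ℤ; 1ℤ; _+_; -_)
open import Data.Product using (_×_)
open import Data.Empty using (⊥)
open import Relation.Nullary using (¬_; Dec; yes; no)
open import Relation.Nullary.Decidable using (_×-dec_; _→-dec_; ¬?)
open import Relation.Binary.PropositionalEquality using (_≡_)
open import Algebra.Core using (Op₂)
open import Algebra.Lattice.Structures using (IsLattice)
import Data.List as L

sumℤ : List ℤ → ℤ
sumℤ = foldr _+_ 0ℤ

elems : (n : ℕ) → List (Fin n)
elems n = L.allFin n

-- A finite (nonempty) lattice, presented with carrier Fin (suc m)
-- (every finite lattice is isomorphic to one of this form).
record FiniteLattice : Set where
  field
    m         : ℕ
    _∨_       : Op₂ (Fin (suc m))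
    _∧_       : Op₂ (Fin (suc m))
    isLattice : IsLattice _≡_ _∨_ _∧_

  Carrier : Set
  Carrier = Fin (suc m)

  card : ℕ
  card = suc m

  infix 4 _≤_ _<_ _≤?_ _<?_
  _≤_ : Carrier → Carrier → Set
  x ≤ y = x ∧ y ≡ x

  _≤?_ : (x y : Carrier) → Dec (x ≤ y)
  x ≤? y = (x ∧ y) ≟ x

  _<_ : Carrier → Carrier → Set
  x < y = x ≤ y × ¬ (x ≡ y)

  _<?_ : (x y : Carrier) → Dec (x < y)
  x <? y = (x ≤? y) ×-dec ¬? (x ≟ y)

  bot : Carrier
  bot = foldr _∧_ Fin.zero (elems card)

  top : Carrier
  top = foldr _∨_ Fin.zero (elems card)

  _⋖_ : Carrier → Carrier → Set
  x ⋖ y = x < y × (∀ z → x < z → ¬ (z < y))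

  _⋖?_ : (x y : Carrier) → Dec (x ⋖ y)
  x ⋖? y = (x <? y) ×-dec all? (λ z → (x <? z) →-dec ¬? (z <? y))

  atoms : List Carrier
  atoms = filter (bot ⋖?_) (elems card)

  ⋁ : List Carrier → Carrier
  ⋁ = foldr _∨_ bot

  MeetSemidistributive : Set
  MeetSemidistributive =
    ∀ x y z → x ∧ y ≡ x ∧ z → x ∧ (y ∨ z) ≡ x ∧ y

  μ-fuel : ℕ → Carrier → Carrier → ℤ
  μ-fuel zero    x y = 0ℤ
  μ-fuel (suc k) x y with x ≟ y
  ... | yes _ = 1ℤ
  ... | no  _ with x ≤? y
  ...   | yes _ = - sumℤ (L.map (μ-fuel k x) (filter (λ z → (x ≤? z) ×-dec (z <? y)) (elems card)))
  ...   | no  _ = 0ℤ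

  -- Any strict chain x = z₀ < z₁ < … < y has at most card - 1 steps, so fuel
  -- card suffices: μ is the Möbius function of the lattice.
  μ : Carrier → Carrier → ℤ
  μ = μ-fuel card

-- In a meet-semidistributive lattice an atom lies below a join of atoms only if it is one
-- of them, so distinct sets of atoms have distinct joins. Consequently μ(0̂, y) = (-1)^k if y
-- is the join of the k atoms below it and μ(0̂, y) = 0 otherwise: for y ≠ 0̂ and an atom
-- a ≤ y, toggling a in the atom set of each atom-join z ≤ y is a sign-reversing involution,
-- so this formula sums to zero over [0̂, y], which is the defining recursion of μ.

module Submission where

open import Defs
open import Data.Bool using (if_then_else_)
open import Data.Nat as ℕ using (ℕ; zero; suc)
import Data.Nat.Properties as ℕP
open import Data.Integer using (ℤ; +0; +[1+_]; -[1+_]; 0ℤ; 1ℤ; _+_; -_)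
import Data.Integer.Properties as ℤP
open import Data.Fin using (Fin; zero; suc)
import Data.Fin.Properties as FinP
import Data.Fin.Permutation as Perm
open import Data.List as L using (List; []; _∷_; filter; length; tabulate)
import Data.List.Properties as LP
open import Data.List.Membership.Propositional using (_∈_)
open import Data.List.Membership.Propositional.Properties using (∈-filter⁺; ∈-filter⁻; ∈-allFin)
open import Data.List.Relation.Unary.Any as Any using (here; there)
open import Data.List.Relation.Unary.All as All using (All)
open import Data.List.Relation.Unary.AllPairs using (_∷_)
open import Data.List.Relation.Unary.Unique.Propositional using (Unique)
import Data.List.Relation.Unary.Unique.Propositional.Properties as Unique
open import Data.Product using (_×_; _,_; proj₁; proj₂; ∃-syntax)
open import Data.Sum using (_⊎_; inj₁; inj₂)
open import Function using (_∘_; _⇔_; mk⇔; Equivalence)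
open import Relation.Nullary using (¬_; Dec; yes; no; does; contradiction)
open import Relation.Nullary.Decidable using (_×-dec_; _⊎-dec_; _→-dec_; ¬?; dec-true; dec-false; decidable-stable)
open import Relation.Unary using (Decidable; _⊆_)
open import Relation.Binary.Definitions using (DecidableEquality)
open import Relation.Binary.PropositionalEquality
open import Relation.Binary.Structures using (IsPartialOrder)
import Relation.Binary.Construct.NonStrictToStrict as NonStrictToStrict
import Relation.Binary.Construct.On as On
import Relation.Binary.Lattice as R
open import Induction.WellFounded using (WellFounded; Acc; acc; module Subrelation)
open import Data.Nat.Induction using () renaming (<-wellFounded to ℕ-<-wellFounded)
open import Level using (0ℓ)
open import Algebra.Lattice.Bundles using (Lattice)
open import Algebra.Lattice.Properties.Lattice using (∨-∧-isOrderTheoreticLattice)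
open import Algebra.Properties.AbelianGroup ℤP.+-0-abelianGroup using (inverseʳ-unique)
open import Algebra.Properties.CommutativeMonoid.Sum ℤP.+-0-commutativeMonoid
  using (sum; sum-cong-≗; sum-permute; sum-replicate-zero; ∑-distrib-+)

open Equivalence using (to; from)
open ≡-Reasoning

module _ {A : Set} where

  filter-cong-∈ : {P Q : A → Set} (P? : Decidable P) (Q? : Decidable Q) (xs : List A) →
                  (∀ {x} → x ∈ xs → P x ⇔ Q x) → filter P? xs ≡ filter Q? xs
  filter-cong-∈ P? Q? []       P⇔Q = refl
  filter-cong-∈ P? Q? (x ∷ xs) P⇔Q with P? x | Q? x
  ... | yes p | yes q = cong (x ∷_) (filter-cong-∈ P? Q? xs (P⇔Q ∘ there))
  ... | yes p | no ¬q = contradiction (to (P⇔Q (here refl)) p) ¬q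
  ... | no ¬p | yes q = contradiction (from (P⇔Q (here refl)) q) ¬p
  ... | no ¬p | no ¬q = filter-cong-∈ P? Q? xs (P⇔Q ∘ there)

  filter-filter-⊆ : {P Q : A → Set} (P? : Decidable P) (Q? : Decidable Q) →
                    P ⊆ Q → ∀ xs → filter P? (filter Q? xs) ≡ filter P? xs
  filter-filter-⊆ P? Q? P⊆Q []       = refl
  filter-filter-⊆ P? Q? P⊆Q (x ∷ xs) with Q? x
  ... | yes _ with P? x
  ...   | yes _ = cong (x ∷_) (filter-filter-⊆ P? Q? P⊆Q xs)
  ...   | no _  = filter-filter-⊆ P? Q? P⊆Q xs
  filter-filter-⊆ P? Q? P⊆Q (x ∷ xs) | no ¬q =
    trans (filter-filter-⊆ P? Q? P⊆Q xs) (sym (LP.filter-reject P? (¬q ∘ P⊆Q)))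

  length-filter-< : {P Q : A → Set} (P? : Decidable P) (Q? : Decidable Q) →
                    P ⊆ Q → ∀ {w} xs → w ∈ xs → Q w → ¬ P w →
                    length (filter P? xs) ℕ.< length (filter Q? xs)
  length-filter-< P? Q? P⊆Q xs w∈xs qw ¬pw =
    subst (ℕ._< length (filter Q? xs)) (cong length (filter-filter-⊆ P? Q? P⊆Q xs))
      (LP.filter-notAll P? (filter Q? xs) (Any.map (λ { refl → ¬pw }) (∈-filter⁺ Q? w∈xs qw)))

sign : ℕ → ℤ
sign zero    = 1ℤ
sign (suc n) = - sign n

sign≢0 : ∀ n → sign n ≢ 0ℤ
sign≢0 (suc n) eq = sign≢0 n (ℤP.neg-injective eq)

Toggle : {A : Set} → (A → Set) → A → A → Set
Toggle P a b = (P b × b ≢ a) ⊎ (¬ P b × b ≡ a)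

toggle-≢ : {A : Set} {P : A → Set} {a b : A} → b ≢ a → Toggle P a b ⇔ P b
toggle-≢ b≢a = mk⇔ Data.Sum.[ proj₁ , (λ (_ , b≡a) → contradiction b≡a b≢a) ] (λ pb → inj₁ (pb , b≢a))

module _ {A : Set} (_≟_ : DecidableEquality A) {P : A → Set} (P? : Decidable P) where

  toggle? : (a : A) → Decidable (Toggle P a)
  toggle? a b = (P? b ×-dec ¬? (b ≟ a)) ⊎-dec (¬? (P? b) ×-dec (b ≟ a))

  toggle-involutive : ∀ {Q : A → Set} {a b} → Q b ⇔ Toggle P a b → Toggle Q a b ⇔ P b
  toggle-involutive {Q} {a} {b} Q⇔T = mk⇔ forth back
    where
    forth : Toggle Q a b → P b
    forth (inj₁ (qb , b≢a)) with to Q⇔T qb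
    ... | inj₁ (pb , _)   = pb
    ... | inj₂ (_ , b≡a)  = contradiction b≡a b≢a
    forth (inj₂ (¬qb , b≡a)) with P? b
    ... | yes pb  = pb
    ... | no ¬pb  = contradiction (from Q⇔T (inj₂ (¬pb , b≡a))) ¬qb
    back : P b → Toggle Q a b
    back pb with b ≟ a
    ... | no b≢a  = inj₁ (from Q⇔T (inj₁ (pb , b≢a)) , b≢a)
    ... | yes b≡a = inj₂ (Data.Sum.[ (λ (_ , b≢a) → b≢a b≡a) , (λ (¬pb , _) → ¬pb pb) ] ∘ to Q⇔T , b≡a)

  filter-toggle-∉ : ∀ {a xs} → All (a ≢_) xs → filter (toggle? a) xs ≡ filter P? xs
  filter-toggle-∉ a∉xs =
    filter-cong-∈ (toggle? _) P? _ (λ b∈xs → toggle-≢ {P = P} (All.lookup a∉xs b∈xs ∘ sym))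

  sign-length-toggle : ∀ {a xs} → Unique xs → a ∈ xs →
    sign (length (filter (toggle? a) xs)) ≡ - sign (length (filter P? xs))
  sign-length-toggle {a} {x ∷ xs} (x∉xs ∷ u) a∈x∷xs = go a∈x∷xs (P? x)
    where
    go : a ∈ x ∷ xs → Dec (P x) →
         sign (length (filter (toggle? a) (x ∷ xs))) ≡ - sign (length (filter P? (x ∷ xs)))
    go (here refl) (yes px) = begin
      sign (length (filter (toggle? a) (x ∷ xs)))  ≡⟨ cong (sign ∘ length) (LP.filter-reject (toggle? a) a∉T) ⟩
      sign (length (filter (toggle? a) xs))        ≡⟨ cong (sign ∘ length) (filter-toggle-∉ x∉xs) ⟩
      sign (length (filter P? xs))                 ≡⟨ ℤP.neg-involutive _ ⟨
      - sign (length (x ∷ filter P? xs))           ≡⟨ cong (-_ ∘ sign ∘ length) (LP.filter-accept P? px) ⟨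
      - sign (length (filter P? (x ∷ xs)))         ∎
      where
      a∉T : ¬ Toggle P a a
      a∉T = Data.Sum.[ (λ (_ , a≢a) → a≢a refl) , (λ (¬pa , _) → ¬pa px) ]
    go (here refl) (no ¬px) = begin
      sign (length (filter (toggle? a) (x ∷ xs)))
        ≡⟨ cong (sign ∘ length) (LP.filter-accept (toggle? a) (inj₂ (¬px , refl))) ⟩
      - sign (length (filter (toggle? a) xs))      ≡⟨ cong (-_ ∘ sign ∘ length) (filter-toggle-∉ x∉xs) ⟩
      - sign (length (filter P? xs))               ≡⟨ cong (-_ ∘ sign ∘ length) (LP.filter-reject P? ¬px) ⟨
      - sign (length (filter P? (x ∷ xs)))         ∎
    go (there a∈xs) (yes px) = begin
      sign (length (filter (toggle? a) (x ∷ xs)))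
        ≡⟨ cong (sign ∘ length) (LP.filter-accept (toggle? a) (from (toggle-≢ {P = P} x≢a) px)) ⟩
      - sign (length (filter (toggle? a) xs))      ≡⟨ cong -_ (sign-length-toggle u a∈xs) ⟩
      - - sign (length (filter P? xs))             ≡⟨ cong (-_ ∘ sign ∘ length) (LP.filter-accept P? px) ⟨
      - sign (length (filter P? (x ∷ xs)))         ∎
      where
      x≢a : x ≢ a
      x≢a = All.lookup x∉xs a∈xs
    go (there a∈xs) (no ¬px) = begin
      sign (length (filter (toggle? a) (x ∷ xs)))
        ≡⟨ cong (sign ∘ length) (LP.filter-reject (toggle? a) (¬px ∘ to (toggle-≢ {P = P} x≢a))) ⟩
      sign (length (filter (toggle? a) xs))        ≡⟨ sign-length-toggle u a∈xs ⟩
      - sign (length (filter P? xs))               ≡⟨ cong (-_ ∘ sign ∘ length) (LP.filter-reject P? ¬px) ⟨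
      - sign (length (filter P? (x ∷ xs)))         ∎
      where
      x≢a : x ≢ a
      x≢a = All.lookup x∉xs a∈xs

when : {P : Set} → Dec P → ℤ → ℤ
when P? v = if does P? then v else 0ℤ

module _ {P : Set} (P? : Dec P) {v : ℤ} where

  when-yes : P → when P? v ≡ v
  when-yes p = cong (if_then v else 0ℤ) (dec-true P? p)

  when-no : ¬ P → when P? v ≡ 0ℤ
  when-no ¬p = cong (if_then v else 0ℤ) (dec-false P? ¬p)

when-cong : {P Q : Set} (P? : Dec P) (Q? : Dec Q) {v w : ℤ} →
            P ⇔ Q → (P → v ≡ w) → when P? v ≡ when Q? w
when-cong P? Q? P⇔Q v≡w with P? | Q?
... | yes p | yes _ = v≡w p
... | yes p | no ¬q = contradiction (to P⇔Q p) ¬q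
... | no ¬p | yes q = contradiction (from P⇔Q q) ¬p
... | no _  | no _  = refl

sumℤ-filter-tabulate : ∀ {B : Set} {n} (t : Fin n → B) {P : B → Set} (P? : Decidable P)
                       (f : B → ℤ) →
  sumℤ (L.map f (filter P? (tabulate t))) ≡ sum (λ i → when (P? (t i)) (f (t i)))
sumℤ-filter-tabulate {n = zero}  t P? f = refl
sumℤ-filter-tabulate {n = suc n} t P? f with P? (t zero)
... | yes _ = cong (f (t zero) +_) (sumℤ-filter-tabulate (t ∘ suc) P? f)
... | no _  = trans (sumℤ-filter-tabulate (t ∘ suc) P? f) (sym (ℤP.+-identityˡ _))

sum-when-≡ : ∀ {n} (f : Fin n → ℤ) (j : Fin n) → sum (λ i → when (i FinP.≟ j) (f i)) ≡ f j
sum-when-≡ {suc n} f zero    = trans (cong (f zero +_) (sum-replicate-zero n)) (ℤP.+-identityʳ _)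
sum-when-≡ {suc n} f (suc j) = trans (ℤP.+-identityˡ _) (sum-when-≡ (f ∘ suc) j)

sum-neg : ∀ {n} (f : Fin n → ℤ) → sum (λ i → - f i) ≡ - sum f
sum-neg {zero}  f = refl
sum-neg {suc n} f =
  trans (cong (- f zero +_) (sum-neg (f ∘ suc))) (sym (ℤP.neg-distrib-+ (f zero) (sum (f ∘ suc))))

i≡-i⇒i≡0 : ∀ {i} → i ≡ - i → i ≡ 0ℤ
i≡-i⇒i≡0 {+0}       _  = refl
i≡-i⇒i≡0 {+[1+ n ]} ()
i≡-i⇒i≡0 { -[1+ n ]} ()

sum-signReversing≡0 : ∀ {n} (f : Fin n → ℤ) (ι : Fin n → Fin n) →
  (∀ i → ι (ι i) ≡ i) → (∀ i → f (ι i) ≡ - f i) → sum f ≡ 0ℤ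
sum-signReversing≡0 f ι ι-involutive f∘ι≡-f = i≡-i⇒i≡0 (begin
  sum f            ≡⟨ sum-permute f (Perm.permutation ι ι ι-involutive ι-involutive) ⟩
  sum (f ∘ ι)      ≡⟨ sum-cong-≗ f∘ι≡-f ⟩
  sum (-_ ∘ f)     ≡⟨ sum-neg f ⟩
  - sum f          ∎)

module FiniteLatticeProperties (𝓛 : FiniteLattice) where

  open FiniteLattice 𝓛
  open FinP using (_≟_)

  private
    lattice : Lattice 0ℓ 0ℓ
    lattice = record { Carrier = Carrier ; _≈_ = _≡_ ; _∨_ = _∨_ ; _∧_ = _∧_ ; isLattice = isLattice }

    module Order = R.IsLattice (∨-∧-isOrderTheoreticLattice lattice)

  ≤-refl : ∀ {x} → x ≤ x
  ≤-refl = sym Order.refl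

  ≤-trans : ∀ {x y z} → x ≤ y → y ≤ z → x ≤ z
  ≤-trans x≤y y≤z = sym (Order.trans (sym x≤y) (sym y≤z))

  ≤-antisym : ∀ {x y} → x ≤ y → y ≤ x → x ≡ y
  ≤-antisym x≤y y≤x = Order.antisym (sym x≤y) (sym y≤x)

  x∧y≤x : ∀ x y → x ∧ y ≤ x
  x∧y≤x x y = sym (Order.x∧y≤x x y)

  x∧y≤y : ∀ x y → x ∧ y ≤ y
  x∧y≤y x y = sym (Order.x∧y≤y x y)

  x≤x∨y : ∀ x y → x ≤ x ∨ y
  x≤x∨y x y = sym (Order.x≤x∨y x y)

  y≤x∨y : ∀ x y → y ≤ x ∨ y
  y≤x∨y x y = sym (Order.y≤x∨y x y)

  ∨-least : ∀ {x y z} → x ≤ z → y ≤ z → x ∨ y ≤ z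
  ∨-least x≤z y≤z = sym (Order.∨-least (sym x≤z) (sym y≤z))

  ≤-isPartialOrder : IsPartialOrder _≡_ _≤_
  ≤-isPartialOrder = record
    { isPreorder = record
      { isEquivalence = isEquivalence
      ; reflexive     = λ { refl → ≤-refl }
      ; trans         = ≤-trans
      }
    ; antisym    = ≤-antisym
    }

  open NonStrictToStrict _≡_ _≤_ using (<-irrefl)

  <-trans : ∀ {x y z} → x < y → y < z → x < z
  <-trans = NonStrictToStrict.<-trans _≡_ _≤_ ≤-isPartialOrder

  foldr-∧-≤ : ∀ {x} e xs → x ∈ xs → L.foldr _∧_ e xs ≤ x
  foldr-∧-≤ e (y ∷ xs) (here refl)  = x∧y≤x y _
  foldr-∧-≤ e (y ∷ xs) (there x∈xs) = ≤-trans (x∧y≤y y _) (foldr-∧-≤ e xs x∈xs)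

  ≤-foldr-∨ : ∀ {x} e xs → x ∈ xs → x ≤ L.foldr _∨_ e xs
  ≤-foldr-∨ e (y ∷ xs) (here refl)  = x≤x∨y y _
  ≤-foldr-∨ e (y ∷ xs) (there x∈xs) = ≤-trans (≤-foldr-∨ e xs x∈xs) (y≤x∨y y _)

  bot-min : ∀ {x} → bot ≤ x
  bot-min {x} = foldr-∧-≤ zero (elems card) (∈-allFin x)

  top-max : ∀ {x} → x ≤ top
  top-max {x} = ≤-foldr-∨ zero (elems card) (∈-allFin x)

  ⋁-upper : ∀ {x xs} → x ∈ xs → x ≤ ⋁ xs
  ⋁-upper = ≤-foldr-∨ bot _

  ⋁-least : ∀ {y} xs → (∀ {x} → x ∈ xs → x ≤ y) → ⋁ xs ≤ y
  ⋁-least []       _      = bot-min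
  ⋁-least (x ∷ xs) xs≤y = ∨-least (xs≤y (here refl)) (⋁-least xs (xs≤y ∘ there))

  rank : Carrier → ℕ
  rank y = length (filter (_<? y) (elems card))

  rank-mono : ∀ {x y} → x < y → rank x ℕ.< rank y
  rank-mono {x} x<y = length-filter-< (_<? x) (_<? _) (λ z<x → <-trans z<x x<y)
                                      (elems card) (∈-allFin x) x<y (<-irrefl refl)

  rank<card : ∀ y → rank y ℕ.< card
  rank<card y = subst (rank y ℕ.<_) (LP.length-tabulate {n = card} (λ i → i))
    (LP.filter-notAll (_<? y) (elems card) (Any.map (λ { refl → <-irrefl refl }) (∈-allFin y)))

  <-wellFounded : WellFounded _<_
  <-wellFounded = Subrelation.wellFounded rank-mono (On.wellFounded rank ℕ-<-wellFounded)

  ¬⋖⇒between : ∀ {x y} → x < y → ¬ x ⋖ y → ∃[ z ] x < z × z < y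
  ¬⋖⇒between {x} {y} x<y ¬x⋖y =
    let z , ¬between = FinP.¬∀⟶∃¬ card _ (λ z → (x <? z) →-dec ¬? (z <? y)) (¬x⋖y ∘ (x<y ,_))
    in z , decidable-stable ((x <? z) ×-dec (z <? y))
                            (λ ¬x<z<y → ¬between (λ x<z z<y → ¬x<z<y (x<z , z<y)))

  Atom : Carrier → Set
  Atom = bot ⋖_

  atom-below : ∀ {y} → bot ≢ y → ∃[ a ] Atom a × a ≤ y
  atom-below {y} = go (<-wellFounded y)
    where
    go : ∀ {y} → Acc _<_ y → bot ≢ y → ∃[ a ] Atom a × a ≤ y
    go {y} (acc below) bot≢y with bot ⋖? y
    ... | yes bot⋖y = y , bot⋖y , ≤-refl
    ... | no ¬bot⋖y =
      let z , bot<z , z<y = ¬⋖⇒between (bot-min , bot≢y) ¬bot⋖y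
          a , atom , a≤z  = go (below z<y) (proj₂ bot<z)
      in a , atom , ≤-trans a≤z (proj₁ z<y)

  ≤-atom : ∀ {a x} → Atom a → x ≤ a → x ≡ bot ⊎ x ≡ a
  ≤-atom {a} {x} (_ , nothing-between) x≤a with x ≟ bot | x ≟ a
  ... | yes x≡bot | _       = inj₁ x≡bot
  ... | no _      | yes x≡a = inj₂ x≡a
  ... | no x≢bot  | no x≢a  = contradiction (x≤a , x≢a) (nothing-between x (bot-min , x≢bot ∘ sym))

  atom-∧ : ∀ {a} → Atom a → ∀ x → a ∧ x ≡ bot ⊎ a ≤ x
  atom-∧ atom x = ≤-atom atom (x∧y≤x _ x)

  atom-≤-atom : ∀ {a b} → Atom a → Atom b → a ≤ b → a ≡ b
  atom-≤-atom (bot<a , _) atom-b a≤b with ≤-atom atom-b a≤b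
  ... | inj₁ a≡bot = contradiction (sym a≡bot) (proj₂ bot<a)
  ... | inj₂ a≡b   = a≡b

  ∈-atoms⁺ : ∀ {a} → Atom a → a ∈ atoms
  ∈-atoms⁺ {a} = ∈-filter⁺ (bot ⋖?_) (∈-allFin a)

  ∈-atoms⁻ : ∀ {a} → a ∈ atoms → Atom a
  ∈-atoms⁻ = proj₂ ∘ ∈-filter⁻ (bot ⋖?_)

  atoms-unique : Unique atoms
  atoms-unique = Unique.filter⁺ (bot ⋖?_) (Unique.allFin⁺ card)

  sum-≤-split : ∀ (f : Carrier → ℤ) y →
    sum (λ z → when (z ≤? y) (f z)) ≡ sum (λ z → when (z <? y) (f z)) + f y
  sum-≤-split f y = begin
    sum (λ z → when (z ≤? y) (f z))  ≡⟨ sum-cong-≗ split ⟩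
    sum (λ z → f< z + f≡ z)          ≡⟨ ∑-distrib-+ f< f≡ ⟩
    sum f< + sum f≡                  ≡⟨ cong (sum f< +_) (sum-when-≡ f y) ⟩
    sum f< + f y                     ∎
    where
    f< f≡ : Carrier → ℤ
    f< z = when (z <? y) (f z)
    f≡ z = when (z ≟ y) (f z)

    split : ∀ z → when (z ≤? y) (f z) ≡ f< z + f≡ z
    split z = by-cases (z ≟ y)
      where
      by-cases : Dec (z ≡ y) → when (z ≤? y) (f z) ≡ f< z + f≡ z
      by-cases (yes z≡y) = begin
        when (z ≤? y) (f z)                       ≡⟨ when-yes (z ≤? y) (subst (z ≤_) z≡y ≤-refl) ⟩
        f z                                       ≡⟨ ℤP.+-identityˡ (f z) ⟨
        0ℤ + f z                                  ≡⟨ cong₂ _+_ (when-no (z <? y) (λ z<y → proj₂ z<y z≡y))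
                                                               (when-yes (z ≟ y) z≡y) ⟨
        f< z + f≡ z                               ∎
      by-cases (no z≢y) = begin
        when (z ≤? y) (f z)  ≡⟨ when-cong (z ≤? y) (z <? y) (mk⇔ (_, z≢y) proj₁) (λ _ → refl) ⟩
        f< z                 ≡⟨ ℤP.+-identityʳ (f< z) ⟨
        f< z + 0ℤ            ≡⟨ cong (f< z +_) (when-no (z ≟ y) z≢y) ⟨
        f< z + f≡ z                               ∎

module MeetSemidistributiveProperties (𝓛 : FiniteLattice) (msd : FiniteLattice.MeetSemidistributive 𝓛) where

  open FiniteLattice 𝓛
  open FiniteLatticeProperties 𝓛
  open FinP using (_≟_)

  ⋁-disjoint : ∀ {b} xs → (∀ {s} → s ∈ xs → b ∧ s ≡ bot) → b ∧ ⋁ xs ≡ bot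
  ⋁-disjoint {b} []       _       = ≤-antisym (x∧y≤y b bot) bot-min
  ⋁-disjoint {b} (s ∷ xs) disjoint =
    trans (msd b s (⋁ xs) (trans b∧s≡bot (sym (⋁-disjoint xs (disjoint ∘ there))))) b∧s≡bot
    where
    b∧s≡bot : b ∧ s ≡ bot
    b∧s≡bot = disjoint (here refl)

  ⋁Atoms : {P : Carrier → Set} → Decidable P → Carrier
  ⋁Atoms P? = ⋁ (filter P? atoms)

  atom≤⋁Atoms⇔ : ∀ {P : Carrier → Set} (P? : Decidable P) {a} → Atom a → a ≤ ⋁Atoms P? ⇔ P a
  atom≤⋁Atoms⇔ {P} P? {a} atom-a = mk⇔ forth (⋁-upper ∘ ∈-filter⁺ P? (∈-atoms⁺ atom-a))
    where
    disjoint : ¬ P a → ∀ {s} → s ∈ filter P? atoms → a ∧ s ≡ bot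
    disjoint ¬pa s∈ with ∈-filter⁻ P? s∈
    ... | s∈atoms , ps with atom-∧ atom-a _
    ...   | inj₁ a∧s≡bot = a∧s≡bot
    ...   | inj₂ a≤s     = contradiction (subst P (sym (atom-≤-atom atom-a (∈-atoms⁻ s∈atoms) a≤s)) ps) ¬pa
    forth : a ≤ ⋁Atoms P? → P a
    forth a≤⋁ = decidable-stable (P? a) λ ¬pa →
      proj₂ (proj₁ atom-a) (trans (sym (⋁-disjoint _ (disjoint ¬pa))) a≤⋁)

  atomsBelow : Carrier → List Carrier
  atomsBelow z = filter (_≤? z) atoms

  atomsBelow-⋁Atoms : ∀ {P : Carrier → Set} (P? : Decidable P) → atomsBelow (⋁Atoms P?) ≡ filter P? atoms
  atomsBelow-⋁Atoms P? = filter-cong-∈ _ P? atoms (atom≤⋁Atoms⇔ P? ∘ ∈-atoms⁻)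

  atomsBelow-bot : atomsBelow bot ≡ []
  atomsBelow-bot = LP.filter-none (_≤? bot) (All.tabulate λ a∈ a≤bot →
    proj₂ (proj₁ (∈-atoms⁻ a∈)) (≤-antisym bot-min a≤bot))

  IsAtomJoin : Carrier → Set
  IsAtomJoin z = ⋁ (atomsBelow z) ≡ z

  ⋁Atoms-isAtomJoin : ∀ {P : Carrier → Set} (P? : Decidable P) → IsAtomJoin (⋁Atoms P?)
  ⋁Atoms-isAtomJoin P? = cong ⋁ (atomsBelow-⋁Atoms P?)

  μ-formula : Carrier → ℤ
  μ-formula z = when (⋁ (atomsBelow z) ≟ z) (sign (length (atomsBelow z)))

  μ-formula-bot : μ-formula bot ≡ 1ℤ
  μ-formula-bot rewrite atomsBelow-bot = when-yes (bot ≟ bot) refl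

  module Toggling {y a : Carrier} (atom-a : Atom a) (a≤y : a ≤ y) where

    toggled : Carrier → Carrier
    toggled z = ⋁Atoms (toggle? _≟_ (_≤? z) a)

    Supported : Carrier → Set
    Supported z = z ≤ y × IsAtomJoin z

    supported? : Decidable Supported
    supported? z = (z ≤? y) ×-dec (⋁ (atomsBelow z) ≟ z)

    ι : Carrier → Carrier
    ι z = if does (supported? z) then toggled z else z

    summand : Carrier → ℤ
    summand z = when (z ≤? y) (μ-formula z)

    toggled-supported : ∀ {z} → Supported z → Supported (toggled z)
    toggled-supported {z} (z≤y , _) = ⋁-least _ below-y , ⋁Atoms-isAtomJoin _
      where
      below-y : ∀ {b} → b ∈ filter (toggle? _≟_ (_≤? z) a) atoms → b ≤ y
      below-y b∈ with proj₂ (∈-filter⁻ (toggle? _≟_ (_≤? z) a) {xs = atoms} b∈)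
      ... | inj₁ (b≤z , _) = ≤-trans b≤z z≤y
      ... | inj₂ (_ , refl) = a≤y

    toggled-involutive : ∀ {z} → IsAtomJoin z → toggled (toggled z) ≡ z
    toggled-involutive {z} z-join = begin
      toggled (toggled z)  ≡⟨ cong ⋁ (filter-cong-∈ (toggle? _≟_ (_≤? toggled z) a) (_≤? z) atoms
                                                     (toggle-twice ∘ ∈-atoms⁻)) ⟩
      ⋁ (atomsBelow z)     ≡⟨ z-join ⟩
      z                    ∎
      where
      toggle-twice : ∀ {b} → Atom b → Toggle (_≤ toggled z) a b ⇔ b ≤ z
      toggle-twice atom-b =
        toggle-involutive _≟_ (_≤? z) {Q = _≤ toggled z} (atom≤⋁Atoms⇔ (toggle? _≟_ (_≤? z) a) atom-b)

    sign-toggled : ∀ z → sign (length (atomsBelow (toggled z))) ≡ - sign (length (atomsBelow z))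
    sign-toggled z = trans (cong (sign ∘ length) (atomsBelow-⋁Atoms _))
                           (sign-length-toggle _≟_ (_≤? z) atoms-unique (∈-atoms⁺ atom-a))

    ι-supported : ∀ {z} → Supported z → ι z ≡ toggled z
    ι-supported {z} s = cong (if_then toggled z else z) (dec-true (supported? z) s)

    ι-unsupported : ∀ {z} → ¬ Supported z → ι z ≡ z
    ι-unsupported {z} ¬s = cong (if_then toggled z else z) (dec-false (supported? z) ¬s)

    summand-supported : ∀ {z} → Supported z → summand z ≡ sign (length (atomsBelow z))
    summand-supported {z} (z≤y , z-join) = trans (when-yes (z ≤? y) z≤y) (when-yes (_ ≟ z) z-join)

    summand-unsupported : ∀ {z} → ¬ Supported z → summand z ≡ 0ℤ
    summand-unsupported {z} ¬s with z ≤? y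
    ... | yes z≤y = when-no (_ ≟ z) (¬s ∘ (z≤y ,_))
    ... | no _    = refl

    ι-involutive : ∀ z → ι (ι z) ≡ z
    ι-involutive z with supported? z
    ... | yes s = trans (cong ι (ι-supported s))
                        (trans (ι-supported (toggled-supported s)) (toggled-involutive (proj₂ s)))
    ... | no ¬s = trans (cong ι (ι-unsupported ¬s)) (ι-unsupported ¬s)

    summand-ι : ∀ z → summand (ι z) ≡ - summand z
    summand-ι z with supported? z
    ... | yes s = begin
      summand (ι z)                           ≡⟨ cong summand (ι-supported s) ⟩
      summand (toggled z)                     ≡⟨ summand-supported (toggled-supported s) ⟩
      sign (length (atomsBelow (toggled z)))  ≡⟨ sign-toggled z ⟩
      - sign (length (atomsBelow z))          ≡⟨ cong -_ (summand-supported s) ⟨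
      - summand z                             ∎
    ... | no ¬s = begin
      summand (ι z)  ≡⟨ cong summand (ι-unsupported ¬s) ⟩
      summand z      ≡⟨ summand-unsupported ¬s ⟩
      0ℤ             ≡⟨ cong -_ (summand-unsupported ¬s) ⟨
      - summand z    ∎

    sum-summand≡0 : sum summand ≡ 0ℤ
    sum-summand≡0 = sum-signReversing≡0 summand ι ι-involutive summand-ι

  sum-μ-formula-≤≡0 : ∀ {y} → bot ≢ y → sum (λ z → when (z ≤? y) (μ-formula z)) ≡ 0ℤ
  sum-μ-formula-≤≡0 bot≢y =
    let _ , atom-a , a≤y = atom-below bot≢y in Toggling.sum-summand≡0 atom-a a≤y

  μ-fuel-bot : ∀ k y → rank y ℕ.< k → μ-fuel k bot y ≡ μ-formula y
  μ-fuel-bot (suc k) y rank<k with bot ≟ y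
  ... | yes refl = sym μ-formula-bot
  ... | no bot≢y with bot ≤? y
  ...   | no bot≰y = contradiction bot-min bot≰y
  ...   | yes _    = sym (inverseʳ-unique _ (μ-formula y) (begin
    sumℤ (L.map (μ-fuel k bot) (filter R? (elems card))) + μ-formula y
      ≡⟨ cong (_+ μ-formula y) strictly-below ⟩
    sum (λ z → when (z <? y) (μ-formula z)) + μ-formula y
      ≡⟨ sum-≤-split μ-formula y ⟨
    sum (λ z → when (z ≤? y) (μ-formula z))
      ≡⟨ sum-μ-formula-≤≡0 bot≢y ⟩
    0ℤ ∎))
    where
    R? : Decidable (λ z → bot ≤ z × z < y)
    R? z = (bot ≤? z) ×-dec (z <? y)
    strictly-below : sumℤ (L.map (μ-fuel k bot) (filter R? (elems card)))
                   ≡ sum (λ z → when (z <? y) (μ-formula z))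
    strictly-below = trans (sumℤ-filter-tabulate (λ z → z) R? (μ-fuel k bot)) (sum-cong-≗ λ z →
      when-cong (R? z) (z <? y) (mk⇔ proj₂ (bot-min ,_))
        (λ (_ , z<y) → μ-fuel-bot k z (ℕP.<-≤-trans (rank-mono z<y) (ℕP.≤-pred rank<k))))

  μ-bot-top : μ bot top ≡ when (⋁ atoms ≟ top) (sign (length atoms))
  μ-bot-top = trans (μ-fuel-bot card top (rank<card top))
    (cong (λ as → when (⋁ as ≟ top) (sign (length as)))
          (LP.filter-all (_≤? top) {xs = atoms} (All.tabulate λ _ → top-max)))

proposition2p13 : (𝓛 : FiniteLattice) → FiniteLattice.MeetSemidistributive 𝓛 →
    let open FiniteLattice 𝓛 in
      (⋁ atoms ≡ top → ¬ (μ bot top ≡ 0ℤ)) × (¬ (μ bot top ≡ 0ℤ) → ⋁ atoms ≡ top)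
proposition2p13 𝓛 msd = atoms-span⇒μ≢0 , μ≢0⇒atoms-span
  where
  open FiniteLattice 𝓛
  open MeetSemidistributiveProperties 𝓛 msd using (μ-bot-top)
  open FinP using (_≟_)

  atoms-span⇒μ≢0 : ⋁ atoms ≡ top → ¬ (μ bot top ≡ 0ℤ)
  atoms-span⇒μ≢0 atoms-span μ≡0 = sign≢0 (length atoms) (begin
    sign (length atoms)                          ≡⟨ when-yes (⋁ atoms ≟ top) atoms-span ⟨
    when (⋁ atoms ≟ top) (sign (length atoms))   ≡⟨ μ-bot-top ⟨
    μ bot top                                    ≡⟨ μ≡0 ⟩
    0ℤ                                           ∎)

  μ≢0⇒atoms-span : ¬ (μ bot top ≡ 0ℤ) → ⋁ atoms ≡ top
  μ≢0⇒atoms-span μ≢0 = decidable-stable (⋁ atoms ≟ top) λ ¬atoms-span →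
    μ≢0 (trans μ-bot-top (when-no (⋁ atoms ≟ top) ¬atoms-span))
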